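{- The instance degrees, partially ordered by instance reducibility, form a Heyting algebra.
   Context: Work in intuitionistic higher-order logic (e.g. the internal language of an elementary topos), without excluded middle and without countable choice. A predicate $\phi$ on a set $A$ is a subset of $A$. A predicate $\phi$ on $A$ is instance reducible to a predicate $\psi$ on $B$, written $\phi\sqsubseteq\psi$, when $\forall x\in A\,\exists y\in B\,(\psi(y)\Rightarrow\phi(x))$. Predicates are instance equivalent when each is instance reducible to the other; the equivalence classes (over predicates on all sets) are the instance degrees, partially ordered by the relation induced by $\sqsubseteq$. -}

module Defs where

open import Level using (Level; suc; _⊔_)
open import Data.Product using (Σ; _×_; _,_)
open import Function.Bundles using (_⇔_)

-- An abstract model of intuitionistic higher-order logic (e.g. the internal
-- language of an elementary topos).  The "sets" are the types in Set ℓ; the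
-- object of truth values Ω is itself such a set (so power sets A → Ω exist,
-- which is what makes the logic higher-order / impredicative).  Eliminations of ∨, ∃, ⊥ only target Ω-propositions,
-- so ∃ is the (truncated) existential of the internal logic, not a Σ-type.
-- No excluded middle and no (countable) choice is assumed.
record HOL (ℓ : Level) : Set (suc ℓ) where
  field
    Ω      : Set ℓ
    holds  : Ω → Set ℓ
    ⊤Ω     : Ω
    ⊤-intro : holds ⊤Ω
    ⊥Ω     : Ω
    ⊥-elim : ∀ {q} → holds ⊥Ω → holds q
    _∧Ω_   : Ω → Ω → Ω
    ∧-intro : ∀ {p q} → holds p → holds q → holds (p ∧Ω q)
    ∧-elim₁ : ∀ {p q} → holds (p ∧Ω q) → holds p
    ∧-elim₂ : ∀ {p q} → holds (p ∧Ω q) → holds q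
    _∨Ω_   : Ω → Ω → Ω
    ∨-intro₁ : ∀ {p q} → holds p → holds (p ∨Ω q)
    ∨-intro₂ : ∀ {p q} → holds q → holds (p ∨Ω q)
    ∨-elim : ∀ {p q r} → holds (p ∨Ω q) → (holds p → holds r) → (holds q → holds r) → holds r
    _⇒Ω_   : Ω → Ω → Ω
    ⇒-intro : ∀ {p q} → (holds p → holds q) → holds (p ⇒Ω q)
    ⇒-elim : ∀ {p q} → holds (p ⇒Ω q) → holds p → holds q
    ∀Ω     : (A : Set ℓ) → (A → Ω) → Ω
    ∀-intro : ∀ {A P} → ((a : A) → holds (P a)) → holds (∀Ω A P)
    ∀-elim : ∀ {A P} → holds (∀Ω A P) → (a : A) → holds (P a)
    ∃Ω     : (A : Set ℓ) → (A → Ω) → Ω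
    ∃-intro : ∀ {A P} (a : A) → holds (P a) → holds (∃Ω A P)
    ∃-elim : ∀ {A P q} → holds (∃Ω A P) → ((a : A) → holds (P a) → holds q) → holds q

module Degrees {ℓ : Level} (H : HOL ℓ) where
  open HOL H

  record Pred : Set (suc ℓ) where
    constructor pred
    field
      dom : Set ℓ
      φ   : dom → Ω
  open Pred public

  _⊑_ : Pred → Pred → Set ℓ
  P ⊑ Q = (x : dom P) → holds (∃Ω (dom Q) (λ y → φ Q y ⇒Ω φ P x))

  -- Since Agda has no quotient types this
  -- is stated on representatives: ⊑ is a preorder, and there are bottom,
  -- top, binary meets, binary joins and Heyting implication, each
  -- characterised by its universal property with respect to ⊑ (hence
  -- well defined on degrees).
  record HeytingDegrees : Set (suc ℓ) where
    field
      ⊑-refl  : ∀ P → P ⊑ P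
      ⊑-trans : ∀ {P Q R} → P ⊑ Q → Q ⊑ R → P ⊑ R
      bot     : Pred
      bot-least : ∀ P → bot ⊑ P
      top     : Pred
      top-greatest : ∀ P → P ⊑ top
      _⊓_     : Pred → Pred → Pred
      ⊓-lb₁   : ∀ P Q → (P ⊓ Q) ⊑ P
      ⊓-lb₂   : ∀ P Q → (P ⊓ Q) ⊑ Q
      ⊓-glb   : ∀ {P Q R} → R ⊑ P → R ⊑ Q → R ⊑ (P ⊓ Q)
      _⊔ᵈ_    : Pred → Pred → Pred
      ⊔-ub₁   : ∀ P Q → P ⊑ (P ⊔ᵈ Q)
      ⊔-ub₂   : ∀ P Q → Q ⊑ (P ⊔ᵈ Q)
      ⊔-lub   : ∀ {P Q R} → P ⊑ R → Q ⊑ R → (P ⊔ᵈ Q) ⊑ R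
      _⇨_     : Pred → Pred → Pred
      ⇨-adj   : ∀ P Q R → ((R ⊓ P) ⊑ Q) ⇔ (R ⊑ (P ⇨ Q))

-- The order is reversed with respect to truth: ψ(y) ⇒ φ(x) says that ψ is the
-- harder instance, so the least degree is the predicate with no instances,
-- the greatest is a single false instance, joins are disjoint sums and meets
-- are pointwise disjunctions on products.  For the Heyting implication P ⇨ Q
-- take as instances all truth values p with ∀a ∃b (Q b ⇒ p ∨ P a); then
-- R ⊓ P ⊑ Q says exactly that every value R r is such an instance.  This is
-- where higher-order logic is used: the instances range over Ω itself.
module Submission where

open import Level using (Level; Lift; lift)
open import Data.Product using (Σ; _×_; _,_; proj₁)
open import Data.Sum using (_⊎_; inj₁; inj₂)
open import Data.Unit using (⊤; tt)
open import Data.Empty using (⊥)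
open import Function.Bundles using (mk⇔)
open import Defs

module InstanceDegrees {ℓ : Level} (H : HOL ℓ) where
  open HOL H
  open Degrees H

  ⇒Ω-refl : ∀ {p} → holds (p ⇒Ω p)
  ⇒Ω-refl = ⇒-intro (λ h → h)

  ⇒Ω-trans : ∀ {p q r} → holds (p ⇒Ω q) → holds (q ⇒Ω r) → holds (p ⇒Ω r)
  ⇒Ω-trans pq qr = ⇒-intro (λ p → ⇒-elim qr (⇒-elim pq p))

  ⊑-refl : ∀ P → P ⊑ P
  ⊑-refl P x = ∃-intro x ⇒Ω-refl

  ⊑-trans : ∀ {P Q R} → P ⊑ Q → Q ⊑ R → P ⊑ R
  ⊑-trans P⊑Q Q⊑R x =
    ∃-elim (P⊑Q x) λ y Qy⇒Px →
    ∃-elim (Q⊑R y) λ z Rz⇒Qy →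
    ∃-intro z (⇒Ω-trans Rz⇒Qy Qy⇒Px)

  ⊥ᴾ : Pred
  ⊥ᴾ = pred (Lift ℓ ⊥) (λ _ → ⊥Ω)

  ⊥ᴾ⊑P : ∀ P → ⊥ᴾ ⊑ P
  ⊥ᴾ⊑P P ()

  ⊤ᴾ : Pred
  ⊤ᴾ = pred (Lift ℓ ⊤) (λ _ → ⊥Ω)

  P⊑⊤ᴾ : ∀ P → P ⊑ ⊤ᴾ
  P⊑⊤ᴾ P x = ∃-intro (lift tt) (⇒-intro ⊥-elim)

  _⊓ᴾ_ : Pred → Pred → Pred
  P ⊓ᴾ Q = pred (dom P × dom Q) (λ (a , b) → φ P a ∨Ω φ Q b)

  P⊓Q⊑P : ∀ P Q → (P ⊓ᴾ Q) ⊑ P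
  P⊓Q⊑P P Q (a , b) = ∃-intro a (⇒-intro ∨-intro₁)

  P⊓Q⊑Q : ∀ P Q → (P ⊓ᴾ Q) ⊑ Q
  P⊓Q⊑Q P Q (a , b) = ∃-intro b (⇒-intro ∨-intro₂)

  ⊓-greatest : ∀ {P Q R} → R ⊑ P → R ⊑ Q → R ⊑ (P ⊓ᴾ Q)
  ⊓-greatest R⊑P R⊑Q r =
    ∃-elim (R⊑P r) λ a Pa⇒Rr →
    ∃-elim (R⊑Q r) λ b Qb⇒Rr →
    ∃-intro (a , b) (⇒-intro λ Pa∨Qb → ∨-elim Pa∨Qb (⇒-elim Pa⇒Rr) (⇒-elim Qb⇒Rr))

  _⊔ᴾ_ : Pred → Pred → Pred
  P ⊔ᴾ Q = pred (dom P ⊎ dom Q) λ { (inj₁ a) → φ P a ; (inj₂ b) → φ Q b }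

  P⊑P⊔Q : ∀ P Q → P ⊑ (P ⊔ᴾ Q)
  P⊑P⊔Q P Q a = ∃-intro (inj₁ a) ⇒Ω-refl

  Q⊑P⊔Q : ∀ P Q → Q ⊑ (P ⊔ᴾ Q)
  Q⊑P⊔Q P Q b = ∃-intro (inj₂ b) ⇒Ω-refl

  ⊔-least : ∀ {P Q R} → P ⊑ R → Q ⊑ R → (P ⊔ᴾ Q) ⊑ R
  ⊔-least P⊑R Q⊑R (inj₁ a) = P⊑R a
  ⊔-least P⊑R Q⊑R (inj₂ b) = Q⊑R b

  IsImplicationInstance : Pred → Pred → Ω → Set ℓ
  IsImplicationInstance P Q p = holds (∀Ω (dom P) λ a → ∃Ω (dom Q) λ b → φ Q b ⇒Ω (p ∨Ω φ P a))

  _⇨ᴾ_ : Pred → Pred → Pred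
  P ⇨ᴾ Q = pred (Σ Ω (IsImplicationInstance P Q)) proj₁

  ⊓⊑⇒⊑⇨ : ∀ {P Q R} → (R ⊓ᴾ P) ⊑ Q → R ⊑ (P ⇨ᴾ Q)
  ⊓⊑⇒⊑⇨ {R = R} R⊓P⊑Q r = ∃-intro (φ R r , ∀-intro λ a → R⊓P⊑Q (r , a)) ⇒Ω-refl

  ⊑⇨⇒⊓⊑ : ∀ {P Q R} → R ⊑ (P ⇨ᴾ Q) → (R ⊓ᴾ P) ⊑ Q
  ⊑⇨⇒⊓⊑ R⊑P⇨Q (r , a) =
    ∃-elim (R⊑P⇨Q r) λ (p , p-instance) p⇒Rr →
    ∃-elim (∀-elim p-instance a) λ b Qb⇒p∨Pa →
    ∃-intro b (⇒-intro λ Qb →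
      ∨-elim (⇒-elim Qb⇒p∨Pa Qb) (λ p → ∨-intro₁ (⇒-elim p⇒Rr p)) ∨-intro₂)

proposition2p4 : {ℓ : Level} → (H : HOL ℓ) → Degrees.HeytingDegrees H
proposition2p4 H = record
  { ⊑-refl       = ⊑-refl
  ; ⊑-trans      = ⊑-trans
  ; bot          = ⊥ᴾ
  ; bot-least    = ⊥ᴾ⊑P
  ; top          = ⊤ᴾ
  ; top-greatest = P⊑⊤ᴾ
  ; _⊓_          = _⊓ᴾ_
  ; ⊓-lb₁        = P⊓Q⊑P
  ; ⊓-lb₂        = P⊓Q⊑Q
  ; ⊓-glb        = ⊓-greatest
  ; _⊔ᵈ_         = _⊔ᴾ_
  ; ⊔-ub₁        = P⊑P⊔Q
  ; ⊔-ub₂        = Q⊑P⊔Q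
  ; ⊔-lub        = ⊔-least
  ; _⇨_          = _⇨ᴾ_
  ; ⇨-adj        = λ P Q R → mk⇔ ⊓⊑⇒⊑⇨ ⊑⇨⇒⊓⊑
  }
  where open InstanceDegrees H
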